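{- Let $G$ and $H$ be connected graphs, both of which have order at least $3$ and girth at least $4$. If either $G$ or $H$ has an isolatable vertex of degree at least $2$, then $G \Box H$ is not well-covered.
   Context: All graphs are finite and simple. A graph is well-covered if all its maximal independent sets have the same cardinality. The girth of a graph is the length of its shortest cycle ($\infty$ for forests). A vertex $w$ of a graph $X$ is isolatable in $X$ if there exists an independent set $J$ of $X$ such that $V(X)-N[J]=\{w\}$, where $N[J]$ is the closed neighborhood of $J$ (the set $J$ together with all vertices adjacent to some vertex of $J$). The Cartesian product $G \Box H$ has vertex set $V(G)\times V(H)$, with $(g_1,h_1)$ adjacent to $(g_2,h_2)$ if either $g_1=g_2$ and $h_1h_2\in E(H)$, or $h_1=h_2$ and $g_1g_2\in E(G)$. -}

module Defs where

open import Data.Nat using (ℕ; zero; suc; _*_; _≤_)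
open import Data.Fin using (Fin; zero; suc; inject₁; fromℕ; remQuot; _≟_)
open import Data.Fin.Subset using (Subset; _∈_; _∉_; _⊆_; ∣_∣)
open import Data.Bool using (Bool; true; false; _∧_; _∨_)
open import Data.Vec using (tabulate)
open import Data.Product using (Σ; _×_; _,_; proj₁; proj₂)
open import Data.Sum using (_⊎_)
open import Relation.Binary.PropositionalEquality using (_≡_)
open import Relation.Nullary using (¬_)
open import Relation.Nullary.Decidable using (⌊_⌋)
open import Function using (Injective)

Adjacency : ℕ → Set
Adjacency n = Fin n → Fin n → Bool

record Graph : Set where
  field
    order : ℕ
    adj   : Adjacency order
    sym   : ∀ u v → adj u v ≡ adj v u
    irrefl : ∀ v → adj v v ≡ false
open Graph public

module _ {n : ℕ} (A : Adjacency n) where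

  Independent : Subset n → Set
  Independent S = ∀ u v → u ∈ S → v ∈ S → A u v ≡ false

  MaximalIndependent : Subset n → Set
  MaximalIndependent S =
    Independent S × (∀ T → Independent T → S ⊆ T → T ⊆ S)

  WellCovered : Set
  WellCovered = ∀ S T → MaximalIndependent S → MaximalIndependent T → ∣ S ∣ ≡ ∣ T ∣

  InClosedNbhd : Subset n → Fin n → Set
  InClosedNbhd J v = v ∈ J ⊎ Σ (Fin n) (λ u → u ∈ J × A u v ≡ true)

  Isolatable : Fin n → Set
  Isolatable w = Σ (Subset n) λ J →
    Independent J × (¬ InClosedNbhd J w) × (∀ v → ¬ (v ≡ w) → InClosedNbhd J v)

  degree : Fin n → ℕ
  degree v = ∣ tabulate (A v) ∣

  data Reachable : Fin n → Fin n → Set where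
    here : ∀ {v} → Reachable v v
    step : ∀ {u w v} → A u w ≡ true → Reachable w v → Reachable u v

  Connected : Set
  Connected = ∀ u v → Reachable u v

  record Cycle (m : ℕ) : Set where
    field
      len≥3 : 3 ≤ suc m
      vtx   : Fin (suc m) → Fin n
      inj   : Injective _≡_ _≡_ vtx
      edges : ∀ (i : Fin m) → A (vtx (inject₁ i)) (vtx (suc i)) ≡ true
      close : A (vtx (fromℕ m)) (vtx zero) ≡ true

  GirthAtLeast4 : Set
  GirthAtLeast4 = ∀ m → Cycle m → 4 ≤ suc m

□-adj : (G H : Graph) → Adjacency (order G * order H)
□-adj G H x y with remQuot (order H) x | remQuot (order H) y
... | g₁ , h₁ | g₂ , h₂ =
  (⌊ g₁ ≟ g₂ ⌋ ∧ adj H h₁ h₂) ∨ (⌊ h₁ ≟ h₂ ⌋ ∧ adj G g₁ g₂)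

module Submission where

-- Let w be isolatable in G, witnessed by J, with neighbours g₁ ≠ g₂, and let y be a vertex of the
-- triangle-free graph H with neighbours x ≠ z (connectivity and order ≥ 3 provide one). In G □ H
--   I = J × {x, z}  ∪  {g₁} × (N(x) − y)  ∪  {g₂} × (N(z) − N(x) − y)
-- is independent, c = (w, y) lies outside N[I], and every neighbour of a = (w, x) or b = (w, z)
-- other than c has a neighbour in I. Extend I ∪ {c} to a maximal independent set T: then c is the
-- only neighbour of a and of b in T, so T − c + a + b is independent with one more vertex than T,
-- and so is every maximal independent set containing it.

open import Defs
open import Data.Bool using (Bool; true; false; _∧_; _∨_)
import Data.Bool.Properties as Bool
open import Data.Bool.Properties using (not-¬; ¬-not; ∨-zeroʳ; ⇔→≡)
open import Data.Empty using (⊥)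
open import Data.Fin using (Fin; zero; suc; _≟_; inject₁; combine; remQuot)
open import Data.Fin.Properties using (any?; suc-injective; remQuot-combine; combine-remQuot)
open import Data.Fin.Subset using (Subset; inside; outside; _∈_; _∉_; _⊆_; ∣_∣; _∪_; ⁅_⁆; _-_; Nonempty)
open import Data.Fin.Subset.Properties
  using (_∈?_; ∣p∣≤n; p⊆q⇒∣p∣≤∣q∣; ∪-identityʳ; p─⊥≡p; p⊆p∪q; q⊆p∪q; x∈p∪q⁻; x∈⁅x⁆; x∈⁅y⁆⇒x≡y; p─q⊆p)
open import Data.Nat using (ℕ; zero; suc; _≤_; _<_; _+_; _*_; s≤s)
open import Data.Nat.Properties using (≤-refl; +-suc; +-identityʳ; m≤n+m; n<1+n; <-irrefl; module ≤-Reasoning)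
open import Data.Product using (Σ; _×_; _,_; proj₁; proj₂; uncurry; swap; map₁)
open import Data.Sum using (_⊎_; inj₁; inj₂; [_,_])
import Data.Sum as Sum
open import Data.Vec using (_∷_; tabulate)
open import Data.Vec.Base using (here; there)
open import Data.Vec.Properties using (lookup∘tabulate; lookup⇒[]=; []=⇒lookup)
open import Function using (_∘_; id)
open import Function.Bundles using (mk⇔)
open import Level using (0ℓ)
open import Relation.Binary.PropositionalEquality using (_≡_; _≢_; refl; trans; cong; cong₂; subst)
import Relation.Binary.PropositionalEquality as ≡
open import Relation.Nullary using (¬_; Dec; yes; no; contradiction; ¬?)
open import Relation.Nullary.Decidable using (⌊_⌋; _⊎-dec_; _×-dec_; decidable-stable; dec-true; isYes≗does)
open import Relation.Unary using (Pred; Decidable)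

∣p∪⁅x⁆∣≡1+∣p∣ : ∀ {n} (p : Subset n) {x} → x ∉ p → ∣ p ∪ ⁅ x ⁆ ∣ ≡ suc ∣ p ∣
∣p∪⁅x⁆∣≡1+∣p∣ (outside ∷ p) {zero}  _   = cong (suc ∘ ∣_∣) (∪-identityʳ p)
∣p∪⁅x⁆∣≡1+∣p∣ (inside  ∷ p) {zero}  x∉p = contradiction here x∉p
∣p∪⁅x⁆∣≡1+∣p∣ (outside ∷ p) {suc x} x∉p = ∣p∪⁅x⁆∣≡1+∣p∣ p (x∉p ∘ there)
∣p∪⁅x⁆∣≡1+∣p∣ (inside  ∷ p) {suc x} x∉p = cong suc (∣p∪⁅x⁆∣≡1+∣p∣ p (x∉p ∘ there))

∣p∣≡1+∣p-x∣ : ∀ {n} (p : Subset n) {x} → x ∈ p → ∣ p ∣ ≡ suc ∣ p - x ∣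
∣p∣≡1+∣p-x∣ (inside  ∷ p) here        = cong (suc ∘ ∣_∣) (≡.sym (p─⊥≡p p))
∣p∣≡1+∣p-x∣ (outside ∷ p) (there x∈p) = ∣p∣≡1+∣p-x∣ p x∈p
∣p∣≡1+∣p-x∣ (inside  ∷ p) (there x∈p) = cong suc (∣p∣≡1+∣p-x∣ p x∈p)

x∈p-y⇒x≢y : ∀ {n} {p : Subset n} {x y} → x ∈ p - y → x ≢ y
x∈p-y⇒x≢y {p = _ ∷ _} {zero}  {zero}  ()
x∈p-y⇒x≢y {p = _ ∷ _} {suc x} {zero}  _           ()
x∈p-y⇒x≢y {p = _ ∷ _} {suc x} {suc y} (there x∈p) = x∈p-y⇒x≢y x∈p ∘ suc-injective
x∈p-y⇒x≢y {p = _ ∷ _} {zero}  {suc y} _           ()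

⌊⌋-true⁺ : ∀ {p} {X : Set p} (X? : Dec X) → X → ⌊ X? ⌋ ≡ true
⌊⌋-true⁺ X? x = trans (isYes≗does X?) (dec-true X? x)

⌊⌋-true⁻ : ∀ {p} {X : Set p} (X? : Dec X) → ⌊ X? ⌋ ≡ true → X
⌊⌋-true⁻ (yes x) _ = x

∈-tabulate⁺ : ∀ {n} {f : Fin n → Bool} {i} → f i ≡ true → i ∈ tabulate f
∈-tabulate⁺ {f = f} {i} fi = lookup⇒[]= i (tabulate f) (trans (lookup∘tabulate f i) fi)

∈-tabulate⁻ : ∀ {n} {f : Fin n → Bool} {i} → i ∈ tabulate f → f i ≡ true
∈-tabulate⁻ {f = f} {i} i∈ = trans (≡.sym (lookup∘tabulate f i)) ([]=⇒lookup i∈)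

1≤∣p∣⇒nonempty : ∀ {n} {p : Subset n} → 1 ≤ ∣ p ∣ → Nonempty p
1≤∣p∣⇒nonempty {p = inside  ∷ p} _ = zero , here
1≤∣p∣⇒nonempty {p = outside ∷ p} 1≤∣p∣ with 1≤∣p∣⇒nonempty 1≤∣p∣
... | x , x∈p = suc x , there x∈p

2≤∣p∣⇒two-elements : ∀ {n} {p : Subset n} → 2 ≤ ∣ p ∣ →
                     Σ (Fin n) λ x → Σ (Fin n) λ y → x ≢ y × x ∈ p × y ∈ p
2≤∣p∣⇒two-elements {p = inside ∷ p} (s≤s 1≤∣p∣) with 1≤∣p∣⇒nonempty 1≤∣p∣
... | y , y∈p = zero , suc y , (λ ()) , here , there y∈p
2≤∣p∣⇒two-elements {p = outside ∷ p} 2≤∣p∣ with 2≤∣p∣⇒two-elements 2≤∣p∣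
... | x , y , x≢y , x∈p , y∈p = suc x , suc y , x≢y ∘ suc-injective , there x∈p , there y∈p

module _ (K : Graph) where

  private
    V = Fin (order K)
    A = adj K

  adj-sym : ∀ {u v} → A u v ≡ true → A v u ≡ true
  adj-sym {u} {v} = trans (Graph.sym K v u)

  adj⇒≢ : ∀ {u v} → A u v ≡ true → u ≢ v
  adj⇒≢ {u} uu refl = not-¬ uu (irrefl K u)

  HasNeighbourIn : Subset (order K) → V → Set
  HasNeighbourIn S v = Σ V λ u → u ∈ S × A u v ≡ true

  inClosedNbhd? : ∀ S v → Dec (InClosedNbhd A S v)
  inClosedNbhd? S v = v ∈? S ⊎-dec any? (λ u → u ∈? S ×-dec A u v Bool.≟ true)

  ∉closedNbhd⇒nonadjacent : ∀ {S v} → ¬ InClosedNbhd A S v → ∀ u → u ∈ S → A u v ≡ false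
  ∉closedNbhd⇒nonadjacent v∉N u u∈S = ¬-not λ uv → v∉N (inj₂ (u , u∈S , uv))

  independent-⊆ : ∀ {S T} → Independent A T → S ⊆ T → Independent A S
  independent-⊆ indT S⊆T u v u∈S v∈S = indT u v (S⊆T u∈S) (S⊆T v∈S)

  independent-∪⁅⁆ : ∀ {S v} → Independent A S → (∀ u → u ∈ S → A u v ≡ false) →
                    Independent A (S ∪ ⁅ v ⁆)
  independent-∪⁅⁆ {S} {v} indS v≁S u u′ u∈ u′∈ with x∈p∪q⁻ S ⁅ v ⁆ u∈ | x∈p∪q⁻ S ⁅ v ⁆ u′∈
  ... | inj₁ u∈S | inj₁ u′∈S = indS u u′ u∈S u′∈S
  ... | inj₁ u∈S | inj₂ u′∈v rewrite x∈⁅y⁆⇒x≡y v u′∈v = v≁S u u∈S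
  ... | inj₂ u∈v | inj₁ u′∈S rewrite x∈⁅y⁆⇒x≡y v u∈v = trans (Graph.sym K v u′) (v≁S u′ u′∈S)
  ... | inj₂ u∈v | inj₂ u′∈v rewrite x∈⁅y⁆⇒x≡y v u∈v | x∈⁅y⁆⇒x≡y v u′∈v = irrefl K v

  dominating⇒maximal : ∀ {S} → Independent A S → (∀ v → InClosedNbhd A S v) → MaximalIndependent A S
  dominating⇒maximal {S} indS dom = indS , maximal
    where
    maximal : ∀ T → Independent A T → S ⊆ T → T ⊆ S
    maximal T indT S⊆T {v} v∈T with dom v
    ... | inj₁ v∈S = v∈S
    ... | inj₂ (u , u∈S , uv) = contradiction (indT u v (S⊆T u∈S) v∈T) (not-¬ uv)

  extend-to-maximal : ∀ {S} → Independent A S → Σ (Subset (order K)) λ T → S ⊆ T × MaximalIndependent A T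
  extend-to-maximal {S} = extend (order K) S (m≤n+m (order K) ∣ S ∣)
    where
    extend : ∀ k S → order K ≤ ∣ S ∣ + k → Independent A S →
             Σ (Subset (order K)) λ T → S ⊆ T × MaximalIndependent A T
    extend k S bound indS with any? (¬? ∘ inClosedNbhd? S)
    ... | no no-free =
      S , id , dominating⇒maximal indS λ v → decidable-stable (inClosedNbhd? S v) (no-free ∘ (v ,_))
    extend zero S bound indS | yes (v , v∉N) = contradiction too-big (<-irrefl refl)
      where
      open ≤-Reasoning
      too-big : ∣ S ∣ < ∣ S ∣
      too-big = begin-strict
        ∣ S ∣             <⟨ n<1+n ∣ S ∣ ⟩
        suc ∣ S ∣         ≡⟨ ∣p∪⁅x⁆∣≡1+∣p∣ S (v∉N ∘ inj₁) ⟨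
        ∣ S ∪ ⁅ v ⁆ ∣     ≤⟨ ∣p∣≤n (S ∪ ⁅ v ⁆) ⟩
        order K           ≤⟨ bound ⟩
        ∣ S ∣ + 0         ≡⟨ +-identityʳ ∣ S ∣ ⟩
        ∣ S ∣             ∎
    extend (suc k) S bound indS | yes (v , v∉N)
      with extend k (S ∪ ⁅ v ⁆) bound′ (independent-∪⁅⁆ indS (∉closedNbhd⇒nonadjacent v∉N))
      where
      bound′ : order K ≤ ∣ S ∪ ⁅ v ⁆ ∣ + k
      bound′ rewrite ∣p∪⁅x⁆∣≡1+∣p∣ S (v∉N ∘ inj₁) = subst (order K ≤_) (+-suc ∣ S ∣ k) bound
    ... | T , S∪v⊆T , maxT = T , S∪v⊆T ∘ p⊆p∪q ⁅ v ⁆ , maxT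

  wellCovered⇒∣independent∣≤∣maximal∣ : WellCovered A → ∀ {S T} → Independent A S →
                                       MaximalIndependent A T → ∣ S ∣ ≤ ∣ T ∣
  wellCovered⇒∣independent∣≤∣maximal∣ wc {S} {T} indS maxT with extend-to-maximal indS
  ... | T′ , S⊆T′ , maxT′ = subst (∣ S ∣ ≤_) (wc T′ T maxT′ maxT) (p⊆q⇒∣p∣≤∣q∣ S⊆T′)

  dominated⇒only-neighbour : ∀ {I T c d} → Independent A T → I ⊆ T →
    (∀ v → A d v ≡ true → v ≢ c → HasNeighbourIn I v) →
    ∀ t → t ∈ T → A d t ≡ true → t ≡ c
  dominated⇒only-neighbour {c = c} indT I⊆T dom t t∈T dt with t ≟ c
  ... | yes t≡c = t≡c
  ... | no t≢c with dom t dt t≢c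
  ...   | u , u∈I , ut = contradiction (indT u t (I⊆T u∈I) t∈T) (not-¬ ut)

  exchange : ∀ {T c a b} → Independent A T → c ∈ T →
    A c a ≡ true → A c b ≡ true → a ≢ b → A a b ≡ false →
    (∀ t → t ∈ T → A a t ≡ true → t ≡ c) → (∀ t → t ∈ T → A b t ≡ true → t ≡ c) →
    Σ (Subset (order K)) λ U → Independent A U × ∣ U ∣ ≡ suc ∣ T ∣
  exchange {T} {c} {a} {b} indT c∈T ca cb a≢b ab only-a only-b =
    ((T - c) ∪ ⁅ a ⁆) ∪ ⁅ b ⁆ , indU , size
    where
    open ≡.≡-Reasoning
    T-c⊆T : T - c ⊆ T
    T-c⊆T = p─q⊆p T ⁅ c ⁆
    nonadjacent-to-T-c : ∀ {d} → (∀ t → t ∈ T → A d t ≡ true → t ≡ c) → ∀ u → u ∈ T - c → A u d ≡ false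
    nonadjacent-to-T-c only u u∈ = ¬-not λ ud → x∈p-y⇒x≢y u∈ (only u (T-c⊆T u∈) (adj-sym ud))
    ∉T : ∀ {d} → A c d ≡ true → d ∉ T
    ∉T cd d∈T = not-¬ cd (indT c _ c∈T d∈T)
    a∉T-c : a ∉ T - c
    a∉T-c = ∉T ca ∘ T-c⊆T
    b∉T-c∪a : b ∉ (T - c) ∪ ⁅ a ⁆
    b∉T-c∪a b∈ with x∈p∪q⁻ (T - c) ⁅ a ⁆ b∈
    ... | inj₁ b∈T-c = ∉T cb (T-c⊆T b∈T-c)
    ... | inj₂ b∈a = a≢b (≡.sym (x∈⁅y⁆⇒x≡y a b∈a))
    indU : Independent A (((T - c) ∪ ⁅ a ⁆) ∪ ⁅ b ⁆)
    indU = independent-∪⁅⁆ (independent-∪⁅⁆ (independent-⊆ indT T-c⊆T) (nonadjacent-to-T-c only-a)) b≁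
      where
      b≁ : ∀ u → u ∈ (T - c) ∪ ⁅ a ⁆ → A u b ≡ false
      b≁ u u∈ with x∈p∪q⁻ (T - c) ⁅ a ⁆ u∈
      ... | inj₁ u∈T-c = nonadjacent-to-T-c only-b u u∈T-c
      ... | inj₂ u∈a rewrite x∈⁅y⁆⇒x≡y a u∈a = ab
    size : ∣ ((T - c) ∪ ⁅ a ⁆) ∪ ⁅ b ⁆ ∣ ≡ suc ∣ T ∣
    size = begin
      ∣ ((T - c) ∪ ⁅ a ⁆) ∪ ⁅ b ⁆ ∣  ≡⟨ ∣p∪⁅x⁆∣≡1+∣p∣ _ b∉T-c∪a ⟩
      suc ∣ (T - c) ∪ ⁅ a ⁆ ∣        ≡⟨ cong suc (∣p∪⁅x⁆∣≡1+∣p∣ _ a∉T-c) ⟩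
      suc (suc ∣ T - c ∣)            ≡⟨ cong suc (∣p∣≡1+∣p-x∣ T c∈T) ⟨
      suc ∣ T ∣                      ∎

  exchange⇒¬wellCovered : ∀ {I c a b} → Independent A I → ¬ InClosedNbhd A I c →
    A c a ≡ true → A c b ≡ true → a ≢ b → A a b ≡ false →
    (∀ v → A a v ≡ true → v ≢ c → HasNeighbourIn I v) →
    (∀ v → A b v ≡ true → v ≢ c → HasNeighbourIn I v) →
    ¬ WellCovered A
  exchange⇒¬wellCovered {I} {c} indI c∉N ca cb a≢b ab dom-a dom-b wc
    with extend-to-maximal (independent-∪⁅⁆ indI (∉closedNbhd⇒nonadjacent c∉N))
  ... | T , I∪c⊆T , maxT@(indT , _)
    with exchange indT (I∪c⊆T (q⊆p∪q I ⁅ c ⁆ (x∈⁅x⁆ c))) ca cb a≢b ab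
           (dominated⇒only-neighbour indT I⊆T dom-a) (dominated⇒only-neighbour indT I⊆T dom-b)
    where
    I⊆T : I ⊆ T
    I⊆T = I∪c⊆T ∘ p⊆p∪q ⁅ c ⁆
  ... | U , indU , ∣U∣≡1+∣T∣ =
    <-irrefl refl (subst (_≤ ∣ T ∣) ∣U∣≡1+∣T∣ (wellCovered⇒∣independent∣≤∣maximal∣ wc indU maxT))

TriangleFree : Graph → Set
TriangleFree K = ∀ {p q r} → adj K p q ≡ true → adj K q r ≡ true → adj K r p ≡ true → ⊥

TwoNeighbours : (K : Graph) → Fin (order K) → Set
TwoNeighbours K v = Σ (Fin (order K)) λ x → Σ (Fin (order K)) λ z → x ≢ z × adj K v x ≡ true × adj K v z ≡ true

girth≥4⇒triangleFree : ∀ K → GirthAtLeast4 (adj K) → TriangleFree K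
girth≥4⇒triangleFree K girth≥4 {p} {q} {r} pq qr rp with girth≥4 2 triangle
  where
  vtx : Fin 3 → Fin (order K)
  vtx zero             = p
  vtx (suc zero)       = q
  vtx (suc (suc zero)) = r
  vtx-injective : ∀ {i j} → vtx i ≡ vtx j → i ≡ j
  vtx-injective {zero}             {zero}             _ = refl
  vtx-injective {zero}             {suc zero}         e = contradiction e (adj⇒≢ K pq)
  vtx-injective {zero}             {suc (suc zero)}   e = contradiction (≡.sym e) (adj⇒≢ K rp)
  vtx-injective {suc zero}         {zero}             e = contradiction (≡.sym e) (adj⇒≢ K pq)
  vtx-injective {suc zero}         {suc zero}         _ = refl
  vtx-injective {suc zero}         {suc (suc zero)}   e = contradiction e (adj⇒≢ K qr)
  vtx-injective {suc (suc zero)}   {zero}             e = contradiction e (adj⇒≢ K rp)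
  vtx-injective {suc (suc zero)}   {suc zero}         e = contradiction (≡.sym e) (adj⇒≢ K qr)
  vtx-injective {suc (suc zero)}   {suc (suc zero)}   _ = refl
  edges : ∀ (i : Fin 2) → adj K (vtx (inject₁ i)) (vtx (suc i)) ≡ true
  edges zero       = pq
  edges (suc zero) = qr
  triangle : Cycle (adj K) 2
  triangle = record { len≥3 = ≤-refl ; vtx = vtx ; inj = vtx-injective ; edges = edges ; close = rp }
... | s≤s (s≤s (s≤s ()))

degree≥2⇒twoNeighbours : ∀ K {v} → 2 ≤ degree (adj K) v → TwoNeighbours K v
degree≥2⇒twoNeighbours K 2≤deg with 2≤∣p∣⇒two-elements 2≤deg
... | x , z , x≢z , x∈ , z∈ = x , z , x≢z , ∈-tabulate⁻ x∈ , ∈-tabulate⁻ z∈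

boundary-edge : ∀ {n ℓ} {A : Adjacency n} {P : Pred (Fin n) ℓ} → Decidable P →
  ∀ {s v} → Reachable A s v → ¬ P s → P v →
  Σ (Fin n) λ p → Σ (Fin n) λ q → A p q ≡ true × ¬ P p × P q
boundary-edge P? here ¬Ps Pv = contradiction Pv ¬Ps
boundary-edge P? (step {w = t} st t⇝v) ¬Ps Pv with P? t
... | yes Pt  = _ , t , st , ¬Ps , Pt
... | no ¬Pt = boundary-edge P? t⇝v ¬Pt Pv

distinct-triple : ∀ {n} → 3 ≤ n → Σ (Fin n) λ a → Σ (Fin n) λ b → Σ (Fin n) λ c → a ≢ b × c ≢ a × c ≢ b
distinct-triple (s≤s (s≤s (s≤s _))) = zero , suc zero , suc (suc zero) , (λ ()) , (λ ()) , (λ ())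

module _ (K : Graph) (connected : Connected (adj K)) where

  edge⇒∃twoNeighbours : ∀ {s u t} → adj K u t ≡ true → s ≢ u → s ≢ t → Σ (Fin (order K)) (TwoNeighbours K)
  edge⇒∃twoNeighbours {s} {u} {t} ut s≢u s≢t
    with boundary-edge (λ v → v ≟ u ⊎-dec v ≟ t) (connected s u) [ s≢u , s≢t ] (inj₁ refl)
  ... | p , q , pq , p∉ , inj₁ refl = u , t , p , (λ t≡p → p∉ (inj₂ (≡.sym t≡p))) , ut , adj-sym K pq
  ... | p , q , pq , p∉ , inj₂ refl = t , u , p , (λ u≡p → p∉ (inj₁ (≡.sym u≡p))) , adj-sym K ut , adj-sym K pq

  connected⇒∃twoNeighbours : 3 ≤ order K → Σ (Fin (order K)) (TwoNeighbours K)
  connected⇒∃twoNeighbours 3≤n with distinct-triple 3≤n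
  ... | a , b , c , a≢b , c≢a , c≢b with connected a b
  ...   | here = contradiction refl a≢b
  ...   | step {w = t} at _ with t ≟ b
  ...     | yes refl = edge⇒∃twoNeighbours at c≢a c≢b
  ...     | no t≢b = edge⇒∃twoNeighbours at (a≢b ∘ ≡.sym) (t≢b ∘ ≡.sym)

module _ (K : Graph) {J w} (w∉N[J] : ¬ InClosedNbhd (adj K) J w) where

  neighbour∉isolating : ∀ {g} → adj K w g ≡ true → g ∉ J
  neighbour∉isolating wg g∈J = w∉N[J] (inj₂ (_ , g∈J , adj-sym K wg))

  neighbour-dominated : (∀ v → ¬ (v ≡ w) → InClosedNbhd (adj K) J v) →
                        ∀ {g} → adj K w g ≡ true → HasNeighbourIn K J g
  neighbour-dominated N[J]-covers wg with N[J]-covers _ (adj⇒≢ K wg ∘ ≡.sym)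
  ... | inj₁ g∈J = contradiction g∈J (neighbour∉isolating wg)
  ... | inj₂ dominated = dominated

-- Coordinates identifying A with the adjacency of K₁ □ K₂. Running the construction against them
-- rather than against □-adj lets the isolatable vertex sit in either factor (see transpose).
record BoxCoordinates (K₁ K₂ : Graph) {N : ℕ} (A : Adjacency N) : Set where
  field
    pair         : Fin (order K₁) → Fin (order K₂) → Fin N
    unpair       : Fin N → Fin (order K₁) × Fin (order K₂)
    pair-unpair  : ∀ v → uncurry pair (unpair v) ≡ v
    unpair-pair  : ∀ g h → unpair (pair g h) ≡ (g , h)
    adj-pair⁻    : ∀ {g g′ h h′} → A (pair g h) (pair g′ h′) ≡ true →
                   (g ≡ g′ × adj K₂ h h′ ≡ true) ⊎ (h ≡ h′ × adj K₁ g g′ ≡ true)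
    adj-pairˡ    : ∀ {g g′} h → adj K₁ g g′ ≡ true → A (pair g h) (pair g′ h) ≡ true
    adj-pairʳ    : ∀ g {h h′} → adj K₂ h h′ ≡ true → A (pair g h) (pair g h′) ≡ true

transpose : ∀ {K₁ K₂ N} {A : Adjacency N} → BoxCoordinates K₁ K₂ A → BoxCoordinates K₂ K₁ A
transpose C = record
  { pair        = λ h g → pair g h
  ; unpair      = swap ∘ unpair
  ; pair-unpair = pair-unpair
  ; unpair-pair = λ h g → cong swap (unpair-pair g h)
  ; adj-pair⁻   = Sum.swap ∘ adj-pair⁻
  ; adj-pairˡ   = λ g → adj-pairʳ g
  ; adj-pairʳ   = λ h → adj-pairˡ h
  }
  where open BoxCoordinates C

module _ {K₁ K₂ N} {A : Adjacency N} (C : BoxCoordinates K₁ K₂ A) where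

  open BoxCoordinates C

  private
    V₁ = Fin (order K₁)
    V₂ = Fin (order K₂)

  pair-elim : ∀ {ℓ} {P : Pred (Fin N) ℓ} → (∀ g h → P (pair g h)) → ∀ v → P v
  pair-elim {P = P} P-pair v = subst P (pair-unpair v) (P-pair (proj₁ (unpair v)) (proj₂ (unpair v)))

  pair-injectiveʳ : ∀ {g h h′} → pair g h ≡ pair g h′ → h ≡ h′
  pair-injectiveʳ {g} {h} {h′} e = cong proj₂ (begin
    (g , h)            ≡⟨ unpair-pair g h ⟨
    unpair (pair g h)  ≡⟨ cong unpair e ⟩
    unpair (pair g h′) ≡⟨ unpair-pair g h′ ⟩
    (g , h′)           ∎)
    where open ≡.≡-Reasoning

  box-irrefl : ∀ v → A v v ≡ false
  box-irrefl = pair-elim λ g h →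
    ¬-not ([ not-¬ (irrefl K₂ h) ∘ proj₂ , not-¬ (irrefl K₁ g) ∘ proj₂ ] ∘ adj-pair⁻)

  box-sym : ∀ u v → A u v ≡ A v u
  box-sym u v = ⇔→≡ (mk⇔ (box-adj-sym u v) (box-adj-sym v u))
    where
    box-adj-sym : ∀ u v → A u v ≡ true → A v u ≡ true
    box-adj-sym = pair-elim λ g h → pair-elim λ g′ h′ → flip ∘ adj-pair⁻
      where
      flip : ∀ {g g′ h h′} → (g ≡ g′ × adj K₂ h h′ ≡ true) ⊎ (h ≡ h′ × adj K₁ g g′ ≡ true) →
             A (pair g′ h′) (pair g h) ≡ true
      flip (inj₁ (refl , hh′)) = adj-pairʳ _ (adj-sym K₂ hh′)
      flip (inj₂ (refl , gg′)) = adj-pairˡ _ (adj-sym K₁ gg′)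

  pairsWhere : ∀ {ℓ} {P : Pred (V₁ × V₂) ℓ} → Decidable P → Subset N
  pairsWhere P? = tabulate (⌊_⌋ ∘ P? ∘ unpair)

  module _ {ℓ} {P : Pred (V₁ × V₂) ℓ} (P? : Decidable P) where

    ∈-pairsWhere⁺ : ∀ {g h} → P (g , h) → pair g h ∈ pairsWhere P?
    ∈-pairsWhere⁺ {g} {h} Pgh = ∈-tabulate⁺ (⌊⌋-true⁺ (P? _) (subst P (≡.sym (unpair-pair g h)) Pgh))

    ∈-pairsWhere⁻ : ∀ {g h} → pair g h ∈ pairsWhere P? → P (g , h)
    ∈-pairsWhere⁻ {g} {h} gh∈ = subst P (unpair-pair g h) (⌊⌋-true⁻ (P? _) (∈-tabulate⁻ gh∈))

    pairsWhere-independent :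
      (∀ {g g′ h} → P (g , h) → P (g′ , h) → adj K₁ g g′ ≢ true) →
      (∀ {g h h′} → P (g , h) → P (g , h′) → adj K₂ h h′ ≢ true) →
      Independent A (pairsWhere P?)
    pairsWhere-independent columns rows = pair-elim λ g h → pair-elim λ g′ h′ gh∈ g′h′∈ →
      ¬-not (nonadjacent (∈-pairsWhere⁻ gh∈) (∈-pairsWhere⁻ g′h′∈) ∘ adj-pair⁻)
      where
      nonadjacent : ∀ {g g′ h h′} → P (g , h) → P (g′ , h′) →
                    ¬ ((g ≡ g′ × adj K₂ h h′ ≡ true) ⊎ (h ≡ h′ × adj K₁ g g′ ≡ true))
      nonadjacent Pgh Pgh′ (inj₁ (refl , hh′)) = rows Pgh Pgh′ hh′
      nonadjacent Pgh Pg′h (inj₂ (refl , gg′)) = columns Pgh Pg′h gg′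

module _ (G H : Graph) where

  private
    V₁ = Fin (order G)
    V₂ = Fin (order H)

    boxFormula : V₁ × V₂ → V₁ × V₂ → Bool
    boxFormula (g₁ , h₁) (g₂ , h₂) = (⌊ g₁ ≟ g₂ ⌋ ∧ adj H h₁ h₂) ∨ (⌊ h₁ ≟ h₂ ⌋ ∧ adj G g₁ g₂)

    □-adj-remQuot : ∀ x y → □-adj G H x y ≡ boxFormula (remQuot (order H) x) (remQuot (order H) y)
    □-adj-remQuot x y with remQuot {order G} (order H) x | remQuot {order G} (order H) y
    ... | _ | _ = refl

    ⌊≟⌋-refl : ∀ {n} (i : Fin n) → ⌊ i ≟ i ⌋ ≡ true
    ⌊≟⌋-refl i = ⌊⌋-true⁺ (i ≟ i) refl

    ∨-∧-true⇒ : ∀ {a b c d} → (a ∧ b) ∨ (c ∧ d) ≡ true → (a ≡ true × b ≡ true) ⊎ (c ≡ true × d ≡ true)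
    ∨-∧-true⇒ {true}  {true}                   _  = inj₁ (refl , refl)
    ∨-∧-true⇒ {true}  {false} {true}  {true}  _  = inj₂ (refl , refl)
    ∨-∧-true⇒ {true}  {false} {true}  {false} ()
    ∨-∧-true⇒ {true}  {false} {false}         ()
    ∨-∧-true⇒ {false} {_}     {true}  {true}  _  = inj₂ (refl , refl)
    ∨-∧-true⇒ {false} {_}     {true}  {false} ()
    ∨-∧-true⇒ {false} {_}     {false}         ()

  □-adj-combine : ∀ g g′ h h′ → □-adj G H (combine g h) (combine g′ h′) ≡
                  (⌊ g ≟ g′ ⌋ ∧ adj H h h′) ∨ (⌊ h ≟ h′ ⌋ ∧ adj G g g′)
  □-adj-combine g g′ h h′ = trans (□-adj-remQuot (combine g h) (combine g′ h′))
    (cong₂ boxFormula (remQuot-combine g h) (remQuot-combine g′ h′))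

  □-adj-combine⁻ : ∀ {g g′ h h′} → □-adj G H (combine g h) (combine g′ h′) ≡ true →
                   (g ≡ g′ × adj H h h′ ≡ true) ⊎ (h ≡ h′ × adj G g g′ ≡ true)
  □-adj-combine⁻ {g} {g′} {h} {h′} e =
    Sum.map (map₁ (⌊⌋-true⁻ (g ≟ g′))) (map₁ (⌊⌋-true⁻ (h ≟ h′)))
      (∨-∧-true⇒ (trans (≡.sym (□-adj-combine g g′ h h′)) e))

  □-adj-combineˡ : ∀ {g g′} h → adj G g g′ ≡ true → □-adj G H (combine g h) (combine g′ h) ≡ true
  □-adj-combineˡ {g} {g′} h gg′ = begin
    □-adj G H (combine g h) (combine g′ h)                ≡⟨ □-adj-combine g g′ h h ⟩
    (⌊ g ≟ g′ ⌋ ∧ adj H h h) ∨ (⌊ h ≟ h ⌋ ∧ adj G g g′)  ≡⟨ cong₂ (λ p q → (⌊ g ≟ g′ ⌋ ∧ adj H h h) ∨ (p ∧ q)) (⌊≟⌋-refl h) gg′ ⟩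
    (⌊ g ≟ g′ ⌋ ∧ adj H h h) ∨ true                      ≡⟨ ∨-zeroʳ _ ⟩
    true                                                 ∎
    where open ≡.≡-Reasoning

  □-adj-combineʳ : ∀ g {h h′} → adj H h h′ ≡ true → □-adj G H (combine g h) (combine g h′) ≡ true
  □-adj-combineʳ g {h} {h′} hh′ = begin
    □-adj G H (combine g h) (combine g h′)                ≡⟨ □-adj-combine g g h h′ ⟩
    (⌊ g ≟ g ⌋ ∧ adj H h h′) ∨ (⌊ h ≟ h′ ⌋ ∧ adj G g g)  ≡⟨ cong₂ (λ p q → (p ∧ q) ∨ (⌊ h ≟ h′ ⌋ ∧ adj G g g)) (⌊≟⌋-refl g) hh′ ⟩
    true                                                 ∎
    where open ≡.≡-Reasoning

  □-coordinates : BoxCoordinates G H (□-adj G H)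
  □-coordinates = record
    { pair        = combine
    ; unpair      = remQuot (order H)
    ; pair-unpair = combine-remQuot {order G} (order H)
    ; unpair-pair = remQuot-combine
    ; adj-pair⁻   = □-adj-combine⁻
    ; adj-pairˡ   = □-adj-combineˡ
    ; adj-pairʳ   = □-adj-combineʳ
    }

_□_ : Graph → Graph → Graph
G □ H = record
  { order  = order G * order H
  ; adj    = □-adj G H
  ; sym    = λ u v → box-sym (□-coordinates G H) u v
  ; irrefl = box-irrefl (□-coordinates G H)
  }

module _ {K₁ K₂ : Graph} (K : Graph) (C : BoxCoordinates K₁ K₂ (adj K)) (K₂-triangleFree : TriangleFree K₂)
  {y x z : Fin (order K₂)} (x≢z : x ≢ z) (yx : adj K₂ y x ≡ true) (yz : adj K₂ y z ≡ true)
  {w J} (J-independent : Independent (adj K₁) J) (w∉N[J] : ¬ InClosedNbhd (adj K₁) J w)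
  (N[J]-covers : ∀ v → ¬ (v ≡ w) → InClosedNbhd (adj K₁) J v)
  {g₁ g₂} (g₁≢g₂ : g₁ ≢ g₂) (wg₁ : adj K₁ w g₁ ≡ true) (wg₂ : adj K₁ w g₂ ≡ true)
  where

  open BoxCoordinates C

  private
    V₁ = Fin (order K₁)
    V₂ = Fin (order K₂)
    A₁ = adj K₁
    A₂ = adj K₂

    x≁z : A₂ x z ≢ true
    x≁z xz = K₂-triangleFree xz (adj-sym K₂ yz) yx

    -- Cover₂ skips the neighbours of x so that no column meets both g₁ and g₂; this is why the
    -- factor containing w need not be triangle-free.
    Base Cover₁ Cover₂ InI : Pred (V₁ × V₂) 0ℓ
    Base   (g , h) = g ∈ J × (h ≡ x ⊎ h ≡ z)
    Cover₁ (g , h) = g ≡ g₁ × h ≢ y × A₂ x h ≡ true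
    Cover₂ (g , h) = g ≡ g₂ × h ≢ y × A₂ x h ≡ false × A₂ z h ≡ true
    InI p = Base p ⊎ Cover₁ p ⊎ Cover₂ p

    InI? : Decidable InI
    InI? (g , h) = (g ∈? J ×-dec (h ≟ x ⊎-dec h ≟ z))
      ⊎-dec (g ≟ g₁ ×-dec ¬? (h ≟ y) ×-dec A₂ x h Bool.≟ true)
      ⊎-dec (g ≟ g₂ ×-dec ¬? (h ≟ y) ×-dec A₂ x h Bool.≟ false ×-dec A₂ z h Bool.≟ true)

    I : Subset (order K)
    I = pairsWhere C InI?

    x≁xz : ∀ {h} → h ≡ x ⊎ h ≡ z → A₂ x h ≢ true
    x≁xz (inj₁ refl) xx = adj⇒≢ K₂ xx refl
    x≁xz (inj₂ refl) xz = x≁z xz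

    z≁xz : ∀ {h} → h ≡ x ⊎ h ≡ z → A₂ z h ≢ true
    z≁xz (inj₁ refl) zx = x≁z (adj-sym K₂ zx)
    z≁xz (inj₂ refl) zz = adj⇒≢ K₂ zz refl

    columns : ∀ {g g′ h} → InI (g , h) → InI (g′ , h) → A₁ g g′ ≢ true
    columns (inj₁ (g∈J , _))     (inj₁ (g′∈J , _))            = not-¬ (J-independent _ _ g∈J g′∈J)
    columns (inj₁ (_ , h∈xz))    (inj₂ (inj₁ (_ , _ , xh)))     = contradiction xh (x≁xz h∈xz)
    columns (inj₁ (_ , h∈xz))    (inj₂ (inj₂ (_ , _ , _ , zh))) = contradiction zh (z≁xz h∈xz)
    columns (inj₂ (inj₁ (_ , _ , xh)))     (inj₁ (_ , h∈xz))    = contradiction xh (x≁xz h∈xz)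
    columns (inj₂ (inj₂ (_ , _ , _ , zh))) (inj₁ (_ , h∈xz))    = contradiction zh (z≁xz h∈xz)
    columns (inj₂ (inj₁ (refl , _)))       (inj₂ (inj₁ (refl , _)))       g₁g₁ = adj⇒≢ K₁ g₁g₁ refl
    columns (inj₂ (inj₁ (_ , _ , xh)))     (inj₂ (inj₂ (_ , _ , x≁h , _))) = contradiction x≁h (not-¬ xh)
    columns (inj₂ (inj₂ (_ , _ , x≁h , _))) (inj₂ (inj₁ (_ , _ , xh)))     = contradiction x≁h (not-¬ xh)
    columns (inj₂ (inj₂ (refl , _)))       (inj₂ (inj₂ (refl , _)))       g₂g₂ = adj⇒≢ K₁ g₂g₂ refl

    rows : ∀ {g h h′} → InI (g , h) → InI (g , h′) → A₂ h h′ ≢ true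
    rows (inj₁ (_ , h∈xz))  (inj₁ (_ , inj₁ refl))              = x≁xz h∈xz ∘ adj-sym K₂
    rows (inj₁ (_ , h∈xz))  (inj₁ (_ , inj₂ refl))              = z≁xz h∈xz ∘ adj-sym K₂
    rows (inj₁ (g∈J , _))   (inj₂ (inj₁ (refl , _)))            = λ _ → neighbour∉isolating K₁ w∉N[J] wg₁ g∈J
    rows (inj₁ (g∈J , _))   (inj₂ (inj₂ (refl , _)))            = λ _ → neighbour∉isolating K₁ w∉N[J] wg₂ g∈J
    rows (inj₂ (inj₁ (refl , _))) (inj₁ (g∈J , _))              = λ _ → neighbour∉isolating K₁ w∉N[J] wg₁ g∈J
    rows (inj₂ (inj₂ (refl , _))) (inj₁ (g∈J , _))              = λ _ → neighbour∉isolating K₁ w∉N[J] wg₂ g∈J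
    rows (inj₂ (inj₁ (_ , _ , xh))) (inj₂ (inj₁ (_ , _ , xh′))) = λ hh′ → K₂-triangleFree hh′ (adj-sym K₂ xh′) xh
    rows (inj₂ (inj₁ (refl , _))) (inj₂ (inj₂ (g₁≡g₂ , _)))     = λ _ → g₁≢g₂ g₁≡g₂
    rows (inj₂ (inj₂ (refl , _))) (inj₂ (inj₁ (g₂≡g₁ , _)))     = λ _ → g₁≢g₂ (≡.sym g₂≡g₁)
    rows (inj₂ (inj₂ (_ , _ , _ , zh))) (inj₂ (inj₂ (_ , _ , _ , zh′))) = λ hh′ → K₂-triangleFree hh′ (adj-sym K₂ zh′) zh

    I-independent : Independent (adj K) I
    I-independent = pairsWhere-independent C InI? columns rows

    c∉N[I] : ¬ InClosedNbhd (adj K) I (pair w y)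
    c∉N[I] (inj₁ wy∈I) = not-in (∈-pairsWhere⁻ C InI? wy∈I)
      where
      not-in : ¬ InI (w , y)
      not-in (inj₁ (w∈J , _))           = w∉N[J] (inj₁ w∈J)
      not-in (inj₂ (inj₁ (_ , y≢y , _))) = y≢y refl
      not-in (inj₂ (inj₂ (_ , y≢y , _))) = y≢y refl
    c∉N[I] (inj₂ (u , u∈I , u~c)) = pair-elim C {P = λ v → v ∈ I → adj K v (pair w y) ≢ true}
      (λ g h gh∈I → nonadjacent (∈-pairsWhere⁻ C InI? gh∈I) ∘ adj-pair⁻) u u∈I u~c
      where
      nonadjacent : ∀ {g h} → InI (g , h) → ¬ ((g ≡ w × A₂ h y ≡ true) ⊎ (h ≡ y × A₁ g w ≡ true))
      nonadjacent (inj₁ (w∈J , _)) (inj₁ (refl , _)) = w∉N[J] (inj₁ w∈J)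
      nonadjacent (inj₂ (inj₁ (refl , _))) (inj₁ (g₁≡w , _)) = adj⇒≢ K₁ wg₁ (≡.sym g₁≡w)
      nonadjacent (inj₂ (inj₂ (refl , _))) (inj₁ (g₂≡w , _)) = adj⇒≢ K₁ wg₂ (≡.sym g₂≡w)
      nonadjacent (inj₁ (_ , inj₁ y≡x)) (inj₂ (refl , _)) = adj⇒≢ K₂ yx y≡x
      nonadjacent (inj₁ (_ , inj₂ y≡z)) (inj₂ (refl , _)) = adj⇒≢ K₂ yz y≡z
      nonadjacent (inj₂ (inj₁ (_ , y≢y , _))) (inj₂ (refl , _)) = y≢y refl
      nonadjacent (inj₂ (inj₂ (_ , y≢y , _))) (inj₂ (refl , _)) = y≢y refl

    dominated-in-column : ∀ {h} → h ≢ y → A₂ x h ≡ true ⊎ A₂ z h ≡ true → HasNeighbourIn K I (pair w h)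
    dominated-in-column {h} h≢y xh⊎zh with A₂ x h Bool.≟ true
    ... | yes xh =
      pair g₁ h , ∈-pairsWhere⁺ C InI? (inj₂ (inj₁ (refl , h≢y , xh))) , adj-pairˡ h (adj-sym K₁ wg₁)
    ... | no x≁h =
      pair g₂ h , ∈-pairsWhere⁺ C InI? (inj₂ (inj₂ (refl , h≢y , ¬-not x≁h , zh))) , adj-pairˡ h (adj-sym K₁ wg₂)
      where
      zh : A₂ z h ≡ true
      zh = [ (λ xh → contradiction xh x≁h) , (λ zh → zh) ] xh⊎zh

    dominated-in-row : ∀ {g h} → A₁ w g ≡ true → h ≡ x ⊎ h ≡ z → HasNeighbourIn K I (pair g h)
    dominated-in-row {h = h} wg h∈xz with neighbour-dominated K₁ w∉N[J] N[J]-covers wg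
    ... | j , j∈J , jg = pair j h , ∈-pairsWhere⁺ C InI? (inj₁ (j∈J , h∈xz)) , adj-pairˡ h jg

    neighbours-dominated : ∀ {t} → t ≡ x ⊎ t ≡ z →
      ∀ v → adj K (pair w t) v ≡ true → v ≢ pair w y → HasNeighbourIn K I v
    neighbours-dominated {t} t∈xz =
      pair-elim C {P = λ v → adj K (pair w t) v ≡ true → v ≢ pair w y → HasNeighbourIn K I v} dominated
      where
      x-or-z-edge : ∀ {h} → t ≡ x ⊎ t ≡ z → A₂ t h ≡ true → A₂ x h ≡ true ⊎ A₂ z h ≡ true
      x-or-z-edge (inj₁ refl) = inj₁
      x-or-z-edge (inj₂ refl) = inj₂
      dominated : ∀ g h → adj K (pair w t) (pair g h) ≡ true → pair g h ≢ pair w y →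
                  HasNeighbourIn K I (pair g h)
      dominated g h wt~gh gh≢c with adj-pair⁻ wt~gh
      ... | inj₁ (refl , th) = dominated-in-column (gh≢c ∘ cong (pair w)) (x-or-z-edge t∈xz th)
      ... | inj₂ (refl , wg) = dominated-in-row wg t∈xz

    a≁b : adj K (pair w x) (pair w z) ≡ false
    a≁b = ¬-not ([ x≁z ∘ proj₂ , x≢z ∘ proj₁ ] ∘ adj-pair⁻)

  isolatable⇒¬wellCovered : ¬ WellCovered (adj K)
  isolatable⇒¬wellCovered =
    exchange⇒¬wellCovered K I-independent c∉N[I] (adj-pairʳ w yx) (adj-pairʳ w yz)
      (x≢z ∘ pair-injectiveʳ C) a≁b (neighbours-dominated (inj₁ refl)) (neighbours-dominated (inj₂ refl))

lemma3p2 : (G H : Graph) →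
    Connected (adj G) → Connected (adj H) →
    3 ≤ order G → 3 ≤ order H →
    GirthAtLeast4 (adj G) → GirthAtLeast4 (adj H) →
    (Σ (Fin (order G)) (λ w → Isolatable (adj G) w × 2 ≤ degree (adj G) w)
    ⊎ Σ (Fin (order H)) (λ w → Isolatable (adj H) w × 2 ≤ degree (adj H) w)) →
    ¬ WellCovered (□-adj G H)
lemma3p2 G H _ H-connected _ 3≤∣H∣ _ H-girth≥4 (inj₁ (w , (J , J-independent , w∉N[J] , N[J]-covers) , 2≤deg))
  with degree≥2⇒twoNeighbours G 2≤deg | connected⇒∃twoNeighbours H H-connected 3≤∣H∣
... | g₁ , g₂ , g₁≢g₂ , wg₁ , wg₂ | y , x , z , x≢z , yx , yz =
  isolatable⇒¬wellCovered (G □ H) (□-coordinates G H) (girth≥4⇒triangleFree H H-girth≥4)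
    x≢z yx yz J-independent w∉N[J] N[J]-covers g₁≢g₂ wg₁ wg₂
lemma3p2 G H G-connected _ 3≤∣G∣ _ G-girth≥4 _ (inj₂ (w , (J , J-independent , w∉N[J] , N[J]-covers) , 2≤deg))
  with degree≥2⇒twoNeighbours H 2≤deg | connected⇒∃twoNeighbours G G-connected 3≤∣G∣
... | h₁ , h₂ , h₁≢h₂ , wh₁ , wh₂ | y , x , z , x≢z , yx , yz =
  isolatable⇒¬wellCovered (G □ H) (transpose (□-coordinates G H)) (girth≥4⇒triangleFree G G-girth≥4)
    x≢z yx yz J-independent w∉N[J] N[J]-covers h₁≢h₂ wh₁ wh₂
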